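{- Let $\mathcal K$ be a GL model and $\Phi$ a finite set of formulas of $\mathcal L^{{\Diamond}^\ast}_{{\Diamond}\forall}$. Then for any point $w$ of $\hat{\mathcal K}$: (a) ${\Diamond}^\ast\Phi$ is true at $(\hat{\mathcal K},w)$ iff $\bigwedge\Phi$ is true at $(\hat{\mathcal K},\infty)$; and (b) ${\Box}^\ast\Phi$ is true at $(\hat{\mathcal K},w)$ iff $\bigvee\Phi$ is true at $(\hat{\mathcal K},\infty)$.
   Context: A GL model is a Kripke model $(W,R,V)$ with $R$ transitive and converse well-founded (no infinite chains $a_0Ra_1Ra_2R\cdots$). For a Kripke model $\mathcal K=(W,R,V)$, $\hat{\mathcal K}$ has domain $W\cup\{\infty\}$ ($\infty$ a new point), relation $R\cup((W\cup\{\infty\})\times\{\infty\})$, and valuation extending $V$ with no variable true at $\infty$. $\mathcal L^{{\Diamond}^\ast}_{{\Diamond}\forall}$: negation-normal-form formulas built from $\top,\bot$, literals $p,\overline p$, $\wedge,\vee,{\Diamond},{\Box},\forall,\exists$ and ${\Diamond}^\ast\Phi$, ${\Box}^\ast\Phi$ for finite sets $\Phi$ of formulas. In a Kripke model with transitive relation, ${\Diamond},{\Box}$ are relational; $\forall\varphi$ ($\exists\varphi$) holds everywhere if $\varphi$ holds at all (some) points and nowhere otherwise; ${\Diamond}^\ast\{\varphi_1,\dots,\varphi_k\}$ holds at $x$ iff there is a set $S$ of points with $x\in S$ such that every point of $S$ has, for each $i$, an $R$-successor in $S$ satisfying $\varphi_i$; ${\Box}^\ast\{\varphi_1,\dots,\varphi_k\}$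 holds exactly where ${\Diamond}^\ast\{\neg\varphi_1,\dots,\neg\varphi_k\}$ fails ($\neg$ the De Morgan dual). -}

module Defs where

open import Level using (Level; 0ℓ) renaming (suc to lsuc)
open import Data.Nat using (ℕ)
open import Data.List using (List; []; _∷_; foldr)
open import Data.Product using (Σ; Σ-syntax; _×_)
open import Data.Sum using (_⊎_)
open import Data.Unit.Polymorphic using (⊤)
open import Data.Empty.Polymorphic using (⊥)
open import Relation.Nullary using (¬_)
open import Function using (flip)
open import Induction.WellFounded using (WellFounded)

record Model : Set₁ where
  field
    W : Set
    R : W → W → Set
    V : ℕ → W → Set
open Model public

Transitive : (M : Model) → Set
Transitive M = ∀ {a b c} → R M a b → R M b c → R M a c

ConverseWellFounded : (M : Model) → Set
ConverseWellFounded M = WellFounded (flip (R M))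

IsGL : Model → Set
IsGL M = Transitive M × ConverseWellFounded M

data Pt (A : Set) : Set where
  pt : A → Pt A
  ∞  : Pt A

hatR : {A : Set} → (A → A → Set) → Pt A → Pt A → Set
hatR r (pt a) (pt b) = r a b
hatR r _      ∞      = ⊤
hatR r ∞      (pt b) = ⊥

hatV : {A : Set} → (ℕ → A → Set) → ℕ → Pt A → Set
hatV v p (pt a) = v p a
hatV v p ∞      = ⊥

hat : Model → Model
hat M = record { W = Pt (W M) ; R = hatR (R M) ; V = hatV (V M) }

-- formulas of L^{◇*}_{◇∀} in negation normal form
data Fm : Set where
  ⊤ᶠ ⊥ᶠ      : Fm
  var nvar   : ℕ → Fm
  _∧ᶠ_ _∨ᶠ_  : Fm → Fm → Fm
  ◇ᶠ □ᶠ      : Fm → Fm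
  ∀ᶠ ∃ᶠ      : Fm → Fm
  ◇* □*      : List Fm → Fm     -- finite sets given as lists

⋀ : List Fm → Fm
⋀ = foldr _∧ᶠ_ ⊤ᶠ

⋁ : List Fm → Fm
⋁ = foldr _∨ᶠ_ ⊥ᶠ

mutual
  sat : (M : Model) → Fm → W M → Set₁
  sat M ⊤ᶠ x = ⊤
  sat M ⊥ᶠ x = ⊥
  sat M (var p) x = Level.Lift (lsuc 0ℓ) (V M p x)
  sat M (nvar p) x = ¬ Level.Lift (lsuc 0ℓ) (V M p x)
  sat M (φ ∧ᶠ ψ) x = sat M φ x × sat M ψ x
  sat M (φ ∨ᶠ ψ) x = sat M φ x ⊎ sat M ψ x
  sat M (◇ᶠ φ) x = Σ[ y ∈ W M ] (Level.Lift (lsuc 0ℓ) (R M x y) × sat M φ y)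
  sat M (□ᶠ φ) x = ∀ y → R M x y → sat M φ y
  sat M (∀ᶠ φ) x = ∀ y → sat M φ y
  sat M (∃ᶠ φ) x = Σ[ y ∈ W M ] sat M φ y
  sat M (◇* Φ) x = Σ[ S ∈ (W M → Set) ] (Level.Lift (lsuc 0ℓ) (S x) × (∀ y → S y → Succ M S Φ y))
  -- □*Φ at x: ◇*{¬φ | φ ∈ Φ} fails at x (¬φ true at z read as φ not true at z)
  sat M (□* Φ) x = ¬ (Σ[ S ∈ (W M → Set) ] (Level.Lift (lsuc 0ℓ) (S x) × (∀ y → S y → SuccNot M S Φ y)))

  Succ : (M : Model) → (W M → Set) → List Fm → W M → Set₁
  Succ M S [] y = ⊤
  Succ M S (φ ∷ Φ) y = (Σ[ z ∈ W M ] (Level.Lift (lsuc 0ℓ) (R M y z × S z) × sat M φ z)) × Succ M S Φ y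

  SuccNot : (M : Model) → (W M → Set) → List Fm → W M → Set₁
  SuccNot M S [] y = ⊤
  SuccNot M S (φ ∷ Φ) y = (Σ[ z ∈ W M ] (Level.Lift (lsuc 0ℓ) (R M y z × S z) × ¬ sat M φ z)) × SuccNot M S Φ y

-- In the extended model every point sees ∞, and ∞ sees only itself. If S witnesses ◇*Φ
-- (or ◇* of the negations) for a nonempty Φ, then every point of S has a successor in S;
-- walking along such successors from w must reach ∞ because R is converse well-founded,
-- and the successors of ∞ in S demanded by the witness can only be ∞ itself, so Φ (resp. its
-- negation) holds at ∞. Conversely, if Φ holds at ∞, the set of all points witnesses ◇*Φ,
-- since ∞ is a successor of everything. Part (b) is the dual; its left-to-right direction is
-- where excluded middle is needed.
{-# OPTIONS --safe #-}
module Submission where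

open import Defs
open import Level using (0ℓ; lift) renaming (suc to lsuc)
open import Data.Product using (Σ-syntax; _×_; _,_)
open import Data.Sum using (inj₁; inj₂)
open import Data.List using (List; []; _∷_)
open import Data.Unit.Polymorphic using (⊤; tt)
open import Function using (flip)
open import Function.Bundles using (_⇔_; mk⇔)
open import Relation.Nullary using (¬_; yes; no; contradiction)
open import Induction.WellFounded using (WellFounded; Acc; acc)
open import Axiom.ExcludedMiddle using (ExcludedMiddle)

module _ {A : Set} {r : A → A → Set} where

  hatR-to-∞ : ∀ y → hatR r y ∞
  hatR-to-∞ (pt _) = tt
  hatR-to-∞ ∞      = tt

  serial-set-contains-∞ : WellFounded (flip r) → (S : Pt A → Set)
    → (∀ y → S y → Σ[ z ∈ Pt A ] (hatR r y z × S z))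
    → ∀ {w} → S w → S ∞
  serial-set-contains-∞ wf S serial {∞}    s∞ = s∞
  serial-set-contains-∞ wf S serial {pt a} sa = walk a (wf a) sa
    where
    walk : ∀ a → Acc (flip r) a → S (pt a) → S ∞
    walk a (acc rs) sa with serial (pt a) sa
    ... | ∞    , _   , s∞ = s∞
    ... | pt b , rab , sb = walk b (rs rab) sb

module _ (K : Model) where

  Succ⇒successor : ∀ {S φ Φ y} → Succ (hat K) S (φ ∷ Φ) y
    → Σ[ z ∈ Pt (W K) ] (hatR (R K) y z × S z)
  Succ⇒successor ((z , lift (yz , sz) , _) , _) = z , yz , sz

  SuccNot⇒successor : ∀ {S φ Φ y} → SuccNot (hat K) S (φ ∷ Φ) y
    → Σ[ z ∈ Pt (W K) ] (hatR (R K) y z × S z)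
  SuccNot⇒successor ((z , lift (yz , sz) , _) , _) = z , yz , sz

  Succ-∞⇒⋀ : ∀ {S} Φ → Succ (hat K) S Φ ∞ → sat (hat K) (⋀ Φ) ∞
  Succ-∞⇒⋀ []      _                                 = tt
  Succ-∞⇒⋀ (φ ∷ Φ) ((∞ , _ , φ∞) , rest)             = φ∞ , Succ-∞⇒⋀ Φ rest
  Succ-∞⇒⋀ (φ ∷ Φ) ((pt _ , lift (() , _) , _) , _)

  SuccNot-∞⇒¬⋁ : ∀ {S} Φ → SuccNot (hat K) S Φ ∞ → ¬ sat (hat K) (⋁ Φ) ∞
  SuccNot-∞⇒¬⋁ (φ ∷ Φ) ((∞ , _ , ¬φ∞) , _)    (inj₁ φ∞) = ¬φ∞ φ∞
  SuccNot-∞⇒¬⋁ (φ ∷ Φ) ((∞ , _ , _)   , rest) (inj₂ ⋁Φ) = SuccNot-∞⇒¬⋁ Φ rest ⋁Φ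
  SuccNot-∞⇒¬⋁ (φ ∷ Φ) ((pt _ , lift (() , _) , _) , _)

  ⋀-∞⇒Succ : ∀ Φ → sat (hat K) (⋀ Φ) ∞ → ∀ y → Succ (hat K) (λ _ → ⊤) Φ y
  ⋀-∞⇒Succ []      _          y = tt
  ⋀-∞⇒Succ (φ ∷ Φ) (φ∞ , ⋀Φ) y = (∞ , lift (hatR-to-∞ y , tt) , φ∞) , ⋀-∞⇒Succ Φ ⋀Φ y

  ¬⋁-∞⇒SuccNot : ∀ Φ → ¬ sat (hat K) (⋁ Φ) ∞ → ∀ y → SuccNot (hat K) (λ _ → ⊤) Φ y
  ¬⋁-∞⇒SuccNot []      _    y = tt
  ¬⋁-∞⇒SuccNot (φ ∷ Φ) ¬⋁φΦ y =
    (∞ , lift (hatR-to-∞ y , tt) , (λ φ∞ → ¬⋁φΦ (inj₁ φ∞))) , ¬⋁-∞⇒SuccNot Φ (λ ⋁Φ → ¬⋁φΦ (inj₂ ⋁Φ)) y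

  ⋀-∞⇒◇* : ∀ Φ w → sat (hat K) (⋀ Φ) ∞ → sat (hat K) (◇* Φ) w
  ⋀-∞⇒◇* Φ w ⋀Φ = (λ _ → ⊤) , lift tt , λ y _ → ⋀-∞⇒Succ Φ ⋀Φ y

  □*⇒⋁-∞ : ExcludedMiddle (lsuc 0ℓ) → ∀ Φ w → sat (hat K) (□* Φ) w → sat (hat K) (⋁ Φ) ∞
  □*⇒⋁-∞ em Φ w □*Φ with em {sat (hat K) (⋁ Φ) ∞}
  ... | yes ⋁Φ = ⋁Φ
  ... | no ¬⋁Φ = contradiction ((λ _ → ⊤) , lift tt , λ y _ → ¬⋁-∞⇒SuccNot Φ ¬⋁Φ y) □*Φ

  module _ (wf : ConverseWellFounded K) where

    ◇*⇒⋀-∞ : ∀ Φ w → sat (hat K) (◇* Φ) w → sat (hat K) (⋀ Φ) ∞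
    ◇*⇒⋀-∞ []        _ _                         = tt
    ◇*⇒⋀-∞ Φ@(_ ∷ _) _ (S , lift w∈S , closed) = Succ-∞⇒⋀ Φ (closed ∞ ∞∈S)
      where
      ∞∈S : S ∞
      ∞∈S = serial-set-contains-∞ wf S (λ y y∈S → Succ⇒successor (closed y y∈S)) w∈S

    ⋁-∞⇒□* : ∀ Φ w → sat (hat K) (⋁ Φ) ∞ → sat (hat K) (□* Φ) w
    ⋁-∞⇒□* []        _ (lift ())
    ⋁-∞⇒□* Φ@(_ ∷ _) _ ⋁Φ (S , lift w∈S , closed) = SuccNot-∞⇒¬⋁ Φ (closed ∞ ∞∈S) ⋁Φ
      where
      ∞∈S : S ∞
      ∞∈S = serial-set-contains-∞ wf S (λ y y∈S → SuccNot⇒successor (closed y y∈S)) w∈S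

lemma8p3 : ExcludedMiddle (lsuc 0ℓ) → (K : Model) → IsGL K → (Φ : List Fm) → (w : W (hat K))
    → (sat (hat K) (◇* Φ) w ⇔ sat (hat K) (⋀ Φ) ∞)
      × (sat (hat K) (□* Φ) w ⇔ sat (hat K) (⋁ Φ) ∞)
lemma8p3 em K (_ , wf) Φ w =
  mk⇔ (◇*⇒⋀-∞ K wf Φ w) (⋀-∞⇒◇* K Φ w) ,
  mk⇔ (□*⇒⋁-∞ K em Φ w) (⋁-∞⇒□* K wf Φ w)
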